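{- Let $t=t_0t_1t_2\cdots=0110100110010110\cdots$ be the Thue–Morse word, the fixed point starting with $0$ of the substitution $0\mapsto 01$, $1\mapsto 10$ (indexed from $0$). For $n\ge1$ define the diagonal word of length $n$ over the alphabet $\{0,1\}\times\{0,1\}$ $$d_n=(t_0,t_{n-1})(t_1,t_{n-2})\cdots(t_{n-1},t_0),$$ i.e. the $(k+1)$-st letter of $d_n$ is $(t_k,t_{n-1-k})$ for $0\le k\le n-1$. Write $\overline{0}=1$, $\overline{1}=0$. Let $\sigma$ be the morphism on $(\{0,1\}^2)^*$ given by $\sigma((i,j))=(i,\overline{j})(\overline{i},j)$ for $i,j\in\{0,1\}$. Let $\beta$ be the map sending a word $w_1w_2\cdots w_m$ ($m\ge2$) over $\{0,1\}^2$ to the word $b(w_1,w_2)\,b(w_2,w_3)\cdots b(w_{m-1},w_m)$ of length $m-1$, where $b((i,j),(i',j'))=(i,j')$. Then $$d_{2n}=\sigma(d_n)\quad\text{and}\quad d_{2n+1}=\beta(d_{2n+2})\qquad\text{for all } n\ge1.$$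
   Context: Symbols $(i,j)$ with $i,j\in\{0,1\}$ are letters of a four-letter alphabet; $d_n$ lists the entries $(t_k,t_\ell)$ of the two-dimensional word $t\times t$ on the anti-diagonal $k+\ell=n-1$, ordered by increasing $k$. -}

module Defs where

open import Data.Bool using (Bool; true; false; not)
open import Data.Nat using (ℕ; zero; suc; _+_; _∸_)
open import Data.List using (List; []; _∷_; _++_; concatMap; map; upTo)
open import Data.Product using (_×_; _,_)
open import Data.Maybe using (Maybe; just; nothing)
open import Function using (_∘_)

-- Binary alphabet {0,1} encoded as Bool (false = 0, true = 1).
Bit : Set
Bit = Bool

Letter : Set
Letter = Bit × Bit

μ : List Bit → List Bit
μ = concatMap (λ a → a ∷ not a ∷ [])

μ^ : ℕ → List Bit
μ^ zero = false ∷ []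
μ^ (suc k) = μ (μ^ k)

nth : {A : Set} → A → List A → ℕ → A
nth d [] _ = d
nth d (x ∷ xs) zero = x
nth d (x ∷ xs) (suc n) = nth d xs n

-- Thue–Morse word t = lim μ^k(0): t_n is the n-th letter of μ^(n+1)(0),
-- a word of length 2^(n+1) > n which is a prefix of the fixed point.
t : ℕ → Bit
t n = nth false (μ^ (suc n)) n

d : ℕ → List Letter
d n = map (λ k → (t k , t (n ∸ 1 ∸ k))) (upTo n)

σ : List Letter → List Letter
σ = concatMap (λ { (i , j) → (i , not j) ∷ (not i , j) ∷ [] })

b : Letter → Letter → Letter
b (i , _) (_ , j') = (i , j')

β : List Letter → List Letter
β [] = []
β (x ∷ []) = []
β (x ∷ y ∷ ws) = b x y ∷ β (y ∷ ws)

-- Since μ^(k+1)(0) = μ(μ^k(0)) and each iterate is a prefix of the next, t₂ᵢ = tᵢ and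
-- t₂ᵢ₊₁ = ¬tᵢ. So the letters of d₂ₙ at positions 2k, 2k+1 are (tₖ, ¬tₙ₋₁₋ₖ), (¬tₖ, tₙ₋₁₋ₖ),
-- which is σ of the k-th letter of dₙ. The β identity needs nothing about t: b pairs the
-- first coordinate at position k with the second at position k+1, whose mirrored index
-- is that of position k in the diagonal word one letter shorter.
module Submission where

open import Defs
open import Data.Nat using (ℕ; zero; suc; _+_; _*_; _∸_; _≤_; _<_; _≥_; z≤n; s≤s)
open import Data.Nat.Properties
  using (≤-trans; ≤-total; <-trans; n<1+n; m≤n*m; *-suc; +-suc; *-monoʳ-≤; *-distribˡ-∸;
         +-∸-assoc; m≤n⇒∃[o]m+o≡n)
open import Data.Bool using (false; true; not)
open import Data.List using (List; []; _∷_; _++_; length; applyUpTo)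
open import Data.List.Properties using (map-upTo)
open import Data.Product using (_×_; ∃; _,_)
open import Data.Sum using (inj₁; inj₂)
open import Relation.Binary.PropositionalEquality
  using (_≡_; refl; sym; trans; cong; cong₂; subst₂; module ≡-Reasoning)
open ≡-Reasoning

length-μ : ∀ w → length (μ w) ≡ 2 * length w
length-μ [] = refl
length-μ (x ∷ w) = begin
  suc (suc (length (μ w))) ≡⟨ cong (λ l → suc (suc l)) (length-μ w) ⟩
  2 + 2 * length w         ≡⟨ sym (*-suc 2 (length w)) ⟩
  2 * suc (length w)       ∎

nth-μ-even : ∀ {a} w i → nth a (μ w) (2 * i) ≡ nth a w i
nth-μ-even [] i = refl
nth-μ-even (x ∷ w) zero = refl
nth-μ-even {a} (x ∷ w) (suc i) = trans (cong (nth a (μ (x ∷ w))) (*-suc 2 i)) (nth-μ-even w i)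

nth-μ-odd : ∀ {a} w i → i < length w → nth a (μ w) (suc (2 * i)) ≡ not (nth a w i)
nth-μ-odd (x ∷ w) zero _ = refl
nth-μ-odd {a} (x ∷ w) (suc i) (s≤s i<∣w∣) =
  trans (cong (λ j → nth a (μ (x ∷ w)) (suc j)) (*-suc 2 i)) (nth-μ-odd w i i<∣w∣)

odd-<-length-μ : ∀ w {i} → i < length w → suc (2 * i) < length (μ w)
odd-<-length-μ w {i} i<∣w∣ = subst₂ _≤_ (*-suc 2 i) (sym (length-μ w)) (*-monoʳ-≤ 2 i<∣w∣)

<-length-μ^ : ∀ k → k < length (μ^ k)
<-length-μ^ zero = s≤s z≤n
<-length-μ^ (suc k) = ≤-trans (s≤s (s≤s (m≤n*m k 2))) (odd-<-length-μ (μ^ k) (<-length-μ^ k))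

<-length-μ^-suc : ∀ i → i < length (μ^ (suc i))
<-length-μ^-suc i = <-trans (n<1+n i) (<-length-μ^ (suc i))

μ^-head : ∀ m → ∃ λ w → μ^ m ≡ false ∷ w
μ^-head zero = [] , refl
μ^-head (suc m) with μ^-head m
... | w , eq = true ∷ μ w , cong μ eq

μ-++ : ∀ u v → μ (u ++ v) ≡ μ u ++ μ v
μ-++ [] v = refl
μ-++ (x ∷ u) v = cong (λ w → x ∷ not x ∷ w) (μ-++ u v)

μ^-prefix : ∀ k m → ∃ λ w → μ^ (k + m) ≡ μ^ k ++ w
μ^-prefix zero m = μ^-head m
μ^-prefix (suc k) m with μ^-prefix k m
... | w , eq = μ w , trans (cong μ eq) (μ-++ (μ^ k) w)

nth-++ˡ : ∀ {A : Set} {a : A} u v {i} → i < length u → nth a (u ++ v) i ≡ nth a u i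
nth-++ˡ (x ∷ u) v {zero} _ = refl
nth-++ˡ (x ∷ u) v {suc i} (s≤s i<∣u∣) = nth-++ˡ u v i<∣u∣

nth-μ^-+ : ∀ k m {i} → i < length (μ^ k) → nth false (μ^ (k + m)) i ≡ nth false (μ^ k) i
nth-μ^-+ k m i<∣μ^k∣ with μ^-prefix k m
... | w , eq = trans (cong (λ u → nth false u _) eq) (nth-++ˡ (μ^ k) w i<∣μ^k∣)

nth-μ^ : ∀ k {i} → i < length (μ^ k) → nth false (μ^ k) i ≡ t i
nth-μ^ k {i} i<∣μ^k∣ with ≤-total k (suc i)
... | inj₁ k≤1+i = let m , k+m≡1+i = m≤n⇒∃[o]m+o≡n k≤1+i in
  trans (sym (nth-μ^-+ k m i<∣μ^k∣)) (cong (λ j → nth false (μ^ j) i) k+m≡1+i)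
... | inj₂ 1+i≤k = let m , 1+i+m≡k = m≤n⇒∃[o]m+o≡n 1+i≤k in
  trans (cong (λ j → nth false (μ^ j) i) (sym 1+i+m≡k))
        (nth-μ^-+ (suc i) m (<-length-μ^-suc i))

t-even : ∀ i → t (2 * i) ≡ t i
t-even i = begin
  t (2 * i)                          ≡⟨ sym (nth-μ^ (suc (suc i)) 2i<∣μ^2+i∣) ⟩
  nth false (μ (μ^ (suc i))) (2 * i) ≡⟨ nth-μ-even (μ^ (suc i)) i ⟩
  t i                                ∎
  where
  2i<∣μ^2+i∣ : 2 * i < length (μ^ (suc (suc i)))
  2i<∣μ^2+i∣ = <-trans (n<1+n _) (odd-<-length-μ (μ^ (suc i)) (<-length-μ^-suc i))

t-odd : ∀ i → t (suc (2 * i)) ≡ not (t i)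
t-odd i = begin
  t (suc (2 * i))
    ≡⟨ sym (nth-μ^ (suc (suc i)) (odd-<-length-μ (μ^ (suc i)) i<∣μ^1+i∣)) ⟩
  nth false (μ (μ^ (suc i))) (suc (2 * i))
    ≡⟨ nth-μ-odd (μ^ (suc i)) i i<∣μ^1+i∣ ⟩
  not (t i) ∎
  where
  i<∣μ^1+i∣ : i < length (μ^ (suc i))
  i<∣μ^1+i∣ = <-length-μ^-suc i

β-applyUpTo : ∀ (g : ℕ → Letter) m →
  β (applyUpTo g (suc (suc m))) ≡ applyUpTo (λ k → b (g k) (g (suc k))) (suc m)
β-applyUpTo g zero = refl
β-applyUpTo g (suc m) = cong (b (g 0) (g 1) ∷_) (β-applyUpTo (λ k → g (suc k)) m)

σ-applyUpTo : ∀ (g h : ℕ → Letter) n →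
  (∀ {k} → k < n → σ (g k ∷ []) ≡ h (2 * k) ∷ h (suc (2 * k)) ∷ []) →
  σ (applyUpTo g n) ≡ applyUpTo h (2 * n)
σ-applyUpTo g h zero _ = refl
σ-applyUpTo g h (suc n) σg≡h = begin
  σ (g 0 ∷ []) ++ σ (applyUpTo (λ k → g (suc k)) n)
    ≡⟨ cong₂ _++_ (σg≡h (s≤s z≤n)) (σ-applyUpTo _ _ n σg≡h-shifted) ⟩
  h 0 ∷ h 1 ∷ applyUpTo (λ k → h (suc (suc k))) (2 * n)
    ≡⟨ cong (applyUpTo h) (sym (*-suc 2 n)) ⟩
  applyUpTo h (2 * suc n) ∎
  where
  σg≡h-shifted : ∀ {k} → k < n →
    σ (g (suc k) ∷ []) ≡ h (suc (suc (2 * k))) ∷ h (suc (suc (suc (2 * k)))) ∷ []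
  σg≡h-shifted {k} k<n =
    trans (σg≡h (s≤s k<n)) (cong (λ j → h j ∷ h (suc j) ∷ []) (*-suc 2 k))

diagonal : ℕ → ℕ → Letter
diagonal n k = (t k , t (n ∸ 1 ∸ k))

d-applyUpTo : ∀ n → d n ≡ applyUpTo (diagonal n) n
d-applyUpTo n = map-upTo (diagonal n) n

β-d-suc : ∀ m → β (d (suc m)) ≡ d m
β-d-suc zero = refl
β-d-suc (suc m) = begin
  β (d (suc (suc m)))                                   ≡⟨ cong β (d-applyUpTo (suc (suc m))) ⟩
  β (applyUpTo (diagonal (suc (suc m))) (suc (suc m))) ≡⟨ β-applyUpTo (diagonal (suc (suc m))) m ⟩
  applyUpTo (diagonal (suc m)) (suc m)                 ≡⟨ sym (d-applyUpTo (suc m)) ⟩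
  d (suc m)                                            ∎

mirror-even : ∀ m {k} → k ≤ m → 2 * suc m ∸ 1 ∸ 2 * k ≡ suc (2 * (m ∸ k))
mirror-even m {k} k≤m = begin
  2 * suc m ∸ 1 ∸ 2 * k ≡⟨ cong (λ x → x ∸ 1 ∸ 2 * k) (*-suc 2 m) ⟩
  suc (2 * m) ∸ 2 * k   ≡⟨ +-∸-assoc 1 (*-monoʳ-≤ 2 k≤m) ⟩
  suc (2 * m ∸ 2 * k)   ≡⟨ cong suc (sym (*-distribˡ-∸ 2 m k)) ⟩
  suc (2 * (m ∸ k))     ∎

mirror-odd : ∀ m k → 2 * suc m ∸ 1 ∸ suc (2 * k) ≡ 2 * (m ∸ k)
mirror-odd m k = begin
  2 * suc m ∸ 1 ∸ suc (2 * k) ≡⟨ cong (λ x → x ∸ 1 ∸ suc (2 * k)) (*-suc 2 m) ⟩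
  2 * m ∸ 2 * k               ≡⟨ sym (*-distribˡ-∸ 2 m k) ⟩
  2 * (m ∸ k)                 ∎

σ-d : ∀ n → σ (d n) ≡ d (2 * n)
σ-d zero = refl
σ-d (suc m) = begin
  σ (d (suc m))                            ≡⟨ cong σ (d-applyUpTo (suc m)) ⟩
  σ (applyUpTo (diagonal (suc m)) (suc m)) ≡⟨ σ-applyUpTo _ (diagonal n′) (suc m) σ-diagonal ⟩
  applyUpTo (diagonal n′) n′               ≡⟨ sym (d-applyUpTo n′) ⟩
  d n′                                     ∎
  where
  n′ : ℕ
  n′ = 2 * suc m

  σ-diagonal : ∀ {k} → k < suc m →
    σ (diagonal (suc m) k ∷ []) ≡ diagonal n′ (2 * k) ∷ diagonal n′ (suc (2 * k)) ∷ []
  σ-diagonal {k} (s≤s k≤m) = sym (cong₂ _∷_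
    (cong₂ _,_ (t-even k) (trans (cong t (mirror-even m k≤m)) (t-odd (m ∸ k))))
    (cong₂ _∷_ (cong₂ _,_ (t-odd k) (trans (cong t (mirror-odd m k)) (t-even (m ∸ k)))) refl))

proposition1 : ∀ (n : ℕ) → n ≥ 1 →
                 (d (2 * n) ≡ σ (d n)) × (d (2 * n + 1) ≡ β (d (2 * n + 2)))
-- Both identities also hold for n = 0.
proposition1 n _ =
  sym (σ-d n) ,
  trans (sym (β-d-suc (2 * n + 1))) (cong (λ m → β (d m)) (sym (+-suc (2 * n) 1)))
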